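{- Let $\lambda$ be a nonzero real number. For every integer $n \geq 1$, \[ b_{n,\lambda}(x)=\sum_{l=0}^{n-1}\lambda^l\binom{n-1}{l}B_l^{(n)}\,b_{n-l}(x)=\sum_{l=0}^n\sum_{m=0}^{n-l}\lambda^l\binom{n-1}{l}\binom{n-l}{m}B_l^{(n)}\,b_m\,x^{n-l-m}. \]
   Context: For a nonzero real $\lambda$, the degenerate ordered Bell polynomials $b_{n,\lambda}(x)$ are defined by the formal power series identity \[ \frac{1}{2-(1+\lambda t)^{1/\lambda}}(1+\lambda t)^{x/\lambda}=\sum_{n=0}^\infty b_{n,\lambda}(x)\frac{t^n}{n!}, \] where $(1+\lambda t)^{a/\lambda}=\exp\big(\tfrac{a}{\lambda}\log(1+\lambda t)\big)$. The (ordinary) ordered Bell polynomials $b_n(x)$ are defined by $\frac{1}{2-e^t}e^{xt}=\sum_{n\ge 0}b_n(x)\frac{t^n}{n!}$, and $b_n=b_n(0)$ are the ordered Bell numbers. The higher-order Bernoulli numbers $B_n^{(\alpha)}$ are defined by $\left(\frac{t}{e^t-1}\right)^\alpha=\sum_{n\ge0}B_n^{(\alpha)}\frac{t^n}{n!}$.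
   Formalization: The parameter λ is a nonzero rational rather than a nonzero real number, and the variable x is rational. -}

module Defs where

open import Data.Nat as ℕ using (ℕ; zero; suc; _∸_; _!)
open import Data.Nat.Properties using (_!≢0)
open import Data.Nat.Combinatorics using (_C_)
open import Data.Integer using (+_; -[1+_])
open import Data.Rational using (ℚ; 0ℚ; 1ℚ; _+_; _*_; _-_; -_; _/_; 1/_; NonZero)

fromℕ : ℕ → ℚ
fromℕ n = (+ n) / 1

_^_ : ℚ → ℕ → ℚ
a ^ zero  = 1ℚ
a ^ suc k = a * (a ^ k)

invFact : ℕ → ℚ
invFact k = (+ 1) / (k !)
  where instance _ = k !≢0

sumTo : ℕ → (ℕ → ℚ) → ℚ
sumTo zero    f = f 0
sumTo (suc n) f = sumTo n f + f (suc n)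

-- Formal power series over ℚ in t, as (ordinary) coefficient sequences:
-- a series f stands for Σ_n f n · t^n.

Series : Set
Series = ℕ → ℚ

const : ℚ → Series
const a zero    = a
const a (suc _) = 0ℚ

_⊕_ : Series → Series → Series
(f ⊕ g) n = f n + g n

_⊖_ : Series → Series → Series
(f ⊖ g) n = f n - g n

scale : ℚ → Series → Series
scale a f n = a * f n

_⊛_ : Series → Series → Series
(f ⊛ g) n = sumTo n (λ k → f k * g (n ∸ k))

spow : Series → ℕ → Series
spow f zero    = const 1ℚ
spow f (suc j) = f ⊛ spow f j

-- exp(f) = Σ_j f^j / j!  for f with zero constant term; the coefficient of
-- t^n only receives contributions from j ≤ n, so the sum is truncated there.
sexp : Series → Series
sexp f n = sumTo n (λ j → invFact j * spow f j n)

-- 1/(1 - g) = Σ_j g^j  for g with zero constant term (truncated likewise).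
sgeom : Series → Series
sgeom g n = sumTo n (λ j → spow g j n)

-- multiplicative inverse of a series h with constant term 1:  1/h = 1/(1-(1-h))
sinv : Series → Series
sinv h = sgeom (const 1ℚ ⊖ h)

expLin : ℚ → Series
expLin a = sexp (λ n → lin n)
  where
  lin : ℕ → ℚ
  lin zero          = 0ℚ
  lin (suc zero)    = a
  lin (suc (suc _)) = 0ℚ

-- log(1 + lam t) = Σ_{k≥1} (-1)^{k-1} lam^k t^k / k
log1p : ℚ → Series
log1p lam zero    = 0ℚ
log1p lam (suc k) = ((- 1ℚ) ^ k) * (lam ^ suc k) * ((+ 1) / suc k)

-- (1 + lam t)^{a/lam} = exp((a/lam) log(1 + lam t))
degExp : (lam : ℚ) → .{{NonZero lam}} → ℚ → Series
degExp lam a = sexp (scale (a * (1/ lam)) (log1p lam))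

-- coefficient of t^n/n!
egf : Series → ℕ → ℚ
egf f n = fromℕ (n !) * f n

-- Degenerate ordered Bell polynomials:
--   1/(2 - (1+lam t)^{1/lam}) · (1+lam t)^{x/lam} = Σ b_{n,lam}(x) t^n/n!
degOrderedBell : (lam : ℚ) → .{{NonZero lam}} → ℕ → ℚ → ℚ
degOrderedBell lam n x =
  egf (sinv (const (fromℕ 2) ⊖ degExp lam 1ℚ) ⊛ degExp lam x) n

-- Ordered Bell polynomials:  1/(2 - e^t) · e^{x t} = Σ b_n(x) t^n/n!
orderedBell : ℕ → ℚ → ℚ
orderedBell n x = egf (sinv (const (fromℕ 2) ⊖ expLin 1ℚ) ⊛ expLin x) n

orderedBellNum : ℕ → ℚ
orderedBellNum n = orderedBell n 0ℚ

-- t/(e^t - 1) = 1 / ((e^t - 1)/t),   (e^t - 1)/t = Σ_k t^k/(k+1)!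
bernGen : Series
bernGen = sinv (λ k → invFact (suc k))

-- Higher-order Bernoulli numbers B_l^{(α)} (for natural order α):
--   (t/(e^t-1))^α = Σ B_l^{(α)} t^l/l!
higherBernoulli : ℕ → ℕ → ℚ
higherBernoulli α l = egf (spow bernGen α) l

{-# OPTIONS --safe #-}
module Submission where

-- Writing L(t) = log(1 + λt)/λ, every degenerate exponential is an ordinary one composed with L:
-- (1 + λt)^{a/λ} = e^{a L(t)}. Composition with a series without constant term is a ring
-- homomorphism commuting with inversion, so the generating function of b_{n,λ}(x) is that of
-- b_n(x) composed with L, and b_{n,λ}(x) = n! Σ_k (b_k(x)/k!) [tⁿ] Lᵏ. The powers of L are
-- given by Lagrange inversion (e^t - 1 inverts log(1 + t)):
--   n [tⁿ] Lᵏ = k λ^{n-k} [t^{n-k}] (t/(e^t - 1))ⁿ,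
-- proved by induction from the differential equations (1 + λt) L′ = 1 and tβ′ = β - β² - tβ
-- for β = t/(e^t - 1). Putting l = n - k gives the first identity; the second is the binomial
-- expansion b_m(x) = Σ_i C(m,i) b_i x^{m-i}.

open import Defs
open import Level using (0ℓ)
open import Data.Nat using (ℕ; zero; suc; _∸_; _≤_; _<_; _≥_; z≤n; s≤s; _!)
import Data.Nat as ℕ
import Data.Nat.Properties as ℕₚ
open import Data.Nat.Combinatorics using (_C_; nCk≡n!/k![n-k]!; k![n∸k]!∣n!; k>n⇒nCk≡0)
open import Data.Nat.DivMod using (m/n*n≡m)
import Data.Integer as ℤ
import Data.Integer.Properties as ℤₚ
import Data.Integer.Solver as ℤ-Solver
open import Data.Rational using (ℚ; 0ℚ; 1ℚ; _+_; _*_; _-_; -_; _/_; 1/_; NonZero; toℚᵘ; fromℚᵘ)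
import Data.Rational.Properties as ℚₚ
import Data.Rational.Unnormalised as ℚᵘ
import Data.Rational.Unnormalised.Properties as ℚᵘₚ
open import Data.Rational.Solver using (module +-*-Solver)
open import Data.Maybe as Maybe using (Maybe)
open import Data.Product using (_×_; _,_)
open import Data.Sum using (inj₁; inj₂)
open import Algebra.Bundles using (CommutativeMonoid; CommutativeRing)
open import Algebra.Structures using (IsCommutativeRing)
import Algebra.Construct.Pointwise ℕ as Pointwise
import Algebra.Properties.CommutativeSemigroup as CommSemigroupProperties
import Algebra.Solver.Ring as RingSolver
import Algebra.Solver.Ring.AlmostCommutativeRing as ACR
open ACR using (_-Raw-AlmostCommutative⟶_)
open import Relation.Nullary.Decidable using (dec⇒maybe)
open import Relation.Binary.PropositionalEquality
  using (_≡_; refl; sym; trans; cong; cong₂; subst; module ≡-Reasoning)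
import Relation.Binary.Reasoning.Setoid as SetoidReasoning

fromℚᵘ-homo-+ : ∀ p q → fromℚᵘ (p ℚᵘ.+ q) ≡ fromℚᵘ p + fromℚᵘ q
fromℚᵘ-homo-+ p q = ℚₚ.toℚᵘ-injective (begin
  toℚᵘ (fromℚᵘ (p ℚᵘ.+ q))                ≈⟨ ℚₚ.toℚᵘ-fromℚᵘ (p ℚᵘ.+ q) ⟩
  p ℚᵘ.+ q                                ≈⟨ ℚᵘₚ.+-cong (ℚᵘₚ.≃-sym (ℚₚ.toℚᵘ-fromℚᵘ p)) (ℚᵘₚ.≃-sym (ℚₚ.toℚᵘ-fromℚᵘ q)) ⟩
  toℚᵘ (fromℚᵘ p) ℚᵘ.+ toℚᵘ (fromℚᵘ q)    ≈⟨ ℚᵘₚ.≃-sym (ℚₚ.toℚᵘ-homo-+ (fromℚᵘ p) (fromℚᵘ q)) ⟩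
  toℚᵘ (fromℚᵘ p + fromℚᵘ q)              ∎)
  where open ℚᵘₚ.≃-Reasoning

fromℚᵘ-homo-* : ∀ p q → fromℚᵘ (p ℚᵘ.* q) ≡ fromℚᵘ p * fromℚᵘ q
fromℚᵘ-homo-* p q = ℚₚ.toℚᵘ-injective (begin
  toℚᵘ (fromℚᵘ (p ℚᵘ.* q))                ≈⟨ ℚₚ.toℚᵘ-fromℚᵘ (p ℚᵘ.* q) ⟩
  p ℚᵘ.* q                                ≈⟨ ℚᵘₚ.*-cong (ℚᵘₚ.≃-sym (ℚₚ.toℚᵘ-fromℚᵘ p)) (ℚᵘₚ.≃-sym (ℚₚ.toℚᵘ-fromℚᵘ q)) ⟩
  toℚᵘ (fromℚᵘ p) ℚᵘ.* toℚᵘ (fromℚᵘ q)    ≈⟨ ℚᵘₚ.≃-sym (ℚₚ.toℚᵘ-homo-* (fromℚᵘ p) (fromℚᵘ q)) ⟩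
  toℚᵘ (fromℚᵘ p * fromℚᵘ q)              ∎)
  where open ℚᵘₚ.≃-Reasoning

module _ (m n : ℕ) where

  private
    m/1 n/1 : ℚᵘ.ℚᵘ
    m/1 = ℚᵘ.mkℚᵘ (ℤ.+ m) 0
    n/1 = ℚᵘ.mkℚᵘ (ℤ.+ n) 0

  fromℕ-+ : fromℕ (m ℕ.+ n) ≡ fromℕ m + fromℕ n
  fromℕ-+ = trans (ℚₚ.fromℚᵘ-cong {ℚᵘ.mkℚᵘ (ℤ.+ (m ℕ.+ n)) 0} {m/1 ℚᵘ.+ n/1} (ℚᵘ.*≡*
      (cong (ℤ._* ℤ.1ℤ) (trans (ℤₚ.pos-+ m n) (sym (cong₂ ℤ._+_ (ℤₚ.*-identityʳ (ℤ.+ m)) (ℤₚ.*-identityʳ (ℤ.+ n))))))))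
    (fromℚᵘ-homo-+ m/1 n/1)

  fromℕ-* : fromℕ (m ℕ.* n) ≡ fromℕ m * fromℕ n
  fromℕ-* = trans (ℚₚ.fromℚᵘ-cong {ℚᵘ.mkℚᵘ (ℤ.+ (m ℕ.* n)) 0} {m/1 ℚᵘ.* n/1} (ℚᵘ.*≡*
      (cong (ℤ._* ℤ.1ℤ) (ℤₚ.pos-* m n))))
    (fromℚᵘ-homo-* m/1 n/1)

fromℕ-suc : ∀ n → fromℕ (suc n) ≡ 1ℚ + fromℕ n
fromℕ-suc = fromℕ-+ 1

fromℕ-*-inverseʳ : ∀ n .{{_ : ℕ.NonZero n}} → fromℕ n * ((ℤ.+ 1) / n) ≡ 1ℚ
fromℕ-*-inverseʳ (suc n) = trans (sym (fromℚᵘ-homo-* n+1/1 1/n+1))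
  (ℚₚ.fromℚᵘ-cong {n+1/1 ℚᵘ.* 1/n+1} {ℚᵘ.1ℚᵘ} (ℚᵘ.*≡*
    (solve 1 (λ a → (a :* con (ℤ.+ 1)) :* con (ℤ.+ 1) := con (ℤ.+ 1) :* (con (ℤ.+ 1) :* a)) refl (ℤ.+ suc n))))
  where
  open ℤ-Solver.+-*-Solver
  n+1/1 1/n+1 : ℚᵘ.ℚᵘ
  n+1/1 = ℚᵘ.mkℚᵘ (ℤ.+ suc n) 0
  1/n+1 = ℚᵘ.mkℚᵘ (ℤ.+ 1) n

n!*invFact[n]≡1 : ∀ n → fromℕ (n !) * invFact n ≡ 1ℚ
n!*invFact[n]≡1 n = fromℕ-*-inverseʳ (n !) {{n ℕₚ.!≢0}}

[n+1]*invFact[n+1]≡invFact[n] : ∀ n → fromℕ (suc n) * invFact (suc n) ≡ invFact n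
[n+1]*invFact[n+1]≡invFact[n] n = begin
  N * I′                        ≡⟨ ℚₚ.*-identityʳ (N * I′) ⟨
  N * I′ * 1ℚ                   ≡⟨ cong (N * I′ *_) (n!*invFact[n]≡1 n) ⟨
  N * I′ * (fromℕ (n !) * I)    ≡⟨ solve 4 (λ N I′ n! I → N :* I′ :* (n! :* I) := N :* n! :* I′ :* I) refl N I′ (fromℕ (n !)) I ⟩
  N * fromℕ (n !) * I′ * I      ≡⟨ cong (λ a → a * I′ * I) (fromℕ-* (suc n) (n !)) ⟨
  fromℕ (suc n !) * I′ * I      ≡⟨ cong (_* I) (n!*invFact[n]≡1 (suc n)) ⟩
  1ℚ * I                        ≡⟨ ℚₚ.*-identityˡ I ⟩
  I                             ∎
  where
  open ≡-Reasoning
  open +-*-Solver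
  N = fromℕ (suc n)
  I = invFact n
  I′ = invFact (suc n)

*-cancelˡ-fromℕ : ∀ n .{{_ : ℕ.NonZero n}} {p q} → fromℕ n * p ≡ fromℕ n * q → p ≡ q
*-cancelˡ-fromℕ n {p} {q} np≡nq = begin
  p                  ≡⟨ ℚₚ.*-identityˡ p ⟨
  1ℚ * p             ≡⟨ cong (_* p) (fromℕ-*-inverseʳ n) ⟨
  fromℕ n * i * p    ≡⟨ solve 3 (λ n i p → n :* i :* p := i :* (n :* p)) refl (fromℕ n) i p ⟩
  i * (fromℕ n * p)  ≡⟨ cong (i *_) np≡nq ⟩
  i * (fromℕ n * q)  ≡⟨ solve 3 (λ n i q → i :* (n :* q) := n :* i :* q) refl (fromℕ n) i q ⟩
  fromℕ n * i * q    ≡⟨ cong (_* q) (fromℕ-*-inverseʳ n) ⟩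
  1ℚ * q             ≡⟨ ℚₚ.*-identityˡ q ⟩
  q                  ∎
  where
  open ≡-Reasoning
  open +-*-Solver
  i = (ℤ.+ 1) / n

nCk*[k!*[n∸k]!]≡n! : ∀ {n k} → k ≤ n → fromℕ (n C k) * (fromℕ (k !) * fromℕ ((n ∸ k) !)) ≡ fromℕ (n !)
nCk*[k!*[n∸k]!]≡n! {n} {k} k≤n = begin
  fromℕ (n C k) * (fromℕ (k !) * fromℕ ((n ∸ k) !))  ≡⟨ cong (fromℕ (n C k) *_) (fromℕ-* (k !) ((n ∸ k) !)) ⟨
  fromℕ (n C k) * fromℕ (k ! ℕ.* (n ∸ k) !)          ≡⟨ fromℕ-* (n C k) _ ⟨
  fromℕ ((n C k) ℕ.* (k ! ℕ.* (n ∸ k) !))            ≡⟨ cong fromℕ ℕ-identity ⟩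
  fromℕ (n !)                                        ∎
  where
  open ≡-Reasoning
  instance _ = k ℕₚ.!* (n ∸ k) !≢0
  ℕ-identity : (n C k) ℕ.* (k ! ℕ.* (n ∸ k) !) ≡ n !
  ℕ-identity = trans (cong (ℕ._* (k ! ℕ.* (n ∸ k) !)) (nCk≡n!/k![n-k]! k≤n)) (m/n*n≡m (k![n∸k]!∣n! k≤n))

open CommSemigroupProperties (CommutativeMonoid.commutativeSemigroup ℚₚ.+-0-commutativeMonoid)
  using () renaming (interchange to +-interchange)

sumTo-cong≤ : ∀ n {f g : ℕ → ℚ} → (∀ k → k ≤ n → f k ≡ g k) → sumTo n f ≡ sumTo n g
sumTo-cong≤ zero    f≗g = f≗g 0 z≤n
sumTo-cong≤ (suc n) f≗g = cong₂ _+_ (sumTo-cong≤ n (λ k k≤n → f≗g k (ℕₚ.m≤n⇒m≤1+n k≤n))) (f≗g (suc n) ℕₚ.≤-refl)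

sumTo-cong : ∀ n {f g : ℕ → ℚ} → (∀ k → f k ≡ g k) → sumTo n f ≡ sumTo n g
sumTo-cong n f≗g = sumTo-cong≤ n (λ k _ → f≗g k)

sumTo-zero : ∀ n {f : ℕ → ℚ} → (∀ k → k ≤ n → f k ≡ 0ℚ) → sumTo n f ≡ 0ℚ
sumTo-zero zero    f≗0 = f≗0 0 z≤n
sumTo-zero (suc n) f≗0 = cong₂ _+_ (sumTo-zero n (λ k k≤n → f≗0 k (ℕₚ.m≤n⇒m≤1+n k≤n))) (f≗0 (suc n) ℕₚ.≤-refl)

sumTo-distrib-+ : ∀ n (f g : ℕ → ℚ) → sumTo n (λ k → f k + g k) ≡ sumTo n f + sumTo n g
sumTo-distrib-+ zero    f g = refl
sumTo-distrib-+ (suc n) f g = trans (cong (_+ (f (suc n) + g (suc n))) (sumTo-distrib-+ n f g))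
                                    (+-interchange (sumTo n f) (sumTo n g) (f (suc n)) (g (suc n)))

sumTo-neg : ∀ n (f : ℕ → ℚ) → sumTo n (λ k → - f k) ≡ - sumTo n f
sumTo-neg zero    f = refl
sumTo-neg (suc n) f = trans (cong (_+ (- f (suc n))) (sumTo-neg n f)) (sym (ℚₚ.neg-distrib-+ (sumTo n f) (f (suc n))))

*-distribˡ-sumTo : ∀ n c (f : ℕ → ℚ) → c * sumTo n f ≡ sumTo n (λ k → c * f k)
*-distribˡ-sumTo zero    c f = refl
*-distribˡ-sumTo (suc n) c f = trans (ℚₚ.*-distribˡ-+ c (sumTo n f) (f (suc n))) (cong (_+ c * f (suc n)) (*-distribˡ-sumTo n c f))

*-distribʳ-sumTo : ∀ n c (f : ℕ → ℚ) → sumTo n f * c ≡ sumTo n (λ k → f k * c)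
*-distribʳ-sumTo zero    c f = refl
*-distribʳ-sumTo (suc n) c f = trans (ℚₚ.*-distribʳ-+ c (sumTo n f) (f (suc n))) (cong (_+ f (suc n) * c) (*-distribʳ-sumTo n c f))

sumTo-*-sumTo : ∀ n m (f g : ℕ → ℚ) → sumTo n f * sumTo m g ≡ sumTo n (λ i → sumTo m (λ j → f i * g j))
sumTo-*-sumTo n m f g = trans (*-distribʳ-sumTo n (sumTo m g) f) (sumTo-cong n (λ i → *-distribˡ-sumTo m (f i) g))

sumTo-sucˡ : ∀ n (f : ℕ → ℚ) → sumTo (suc n) f ≡ f 0 + sumTo n (λ k → f (suc k))
sumTo-sucˡ zero    f = refl
sumTo-sucˡ (suc n) f = trans (cong (_+ f (suc (suc n))) (sumTo-sucˡ n f)) (ℚₚ.+-assoc (f 0) _ _)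

sumTo-reverse : ∀ n (f : ℕ → ℚ) → sumTo n f ≡ sumTo n (λ k → f (n ∸ k))
sumTo-reverse zero    f = refl
sumTo-reverse (suc n) f = begin
  sumTo n f + f (suc n)                   ≡⟨ ℚₚ.+-comm (sumTo n f) (f (suc n)) ⟩
  f (suc n) + sumTo n f                   ≡⟨ cong (f (suc n) +_) (sumTo-reverse n f) ⟩
  f (suc n) + sumTo n (λ k → f (n ∸ k))   ≡⟨ sumTo-sucˡ n (λ k → f (suc n ∸ k)) ⟨
  sumTo (suc n) (λ k → f (suc n ∸ k))     ∎
  where open ≡-Reasoning

sumTo-truncate : ∀ m N (f : ℕ → ℚ) → m ≤ N → (∀ k → m < k → k ≤ N → f k ≡ 0ℚ) → sumTo N f ≡ sumTo m f
sumTo-truncate m zero    f z≤n       tail≗0 = refl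
sumTo-truncate m (suc N) f m≤1+N     tail≗0 with ℕₚ.m≤n⇒m<n∨m≡n m≤1+N
... | inj₂ refl      = refl
... | inj₁ (s≤s m≤N) = begin
  sumTo N f + f (suc N)  ≡⟨ cong₂ _+_ (sumTo-truncate m N f m≤N (λ k m<k k≤N → tail≗0 k m<k (ℕₚ.m≤n⇒m≤1+n k≤N)))
                                      (tail≗0 (suc N) (s≤s m≤N) ℕₚ.≤-refl) ⟩
  sumTo m f + 0ℚ         ≡⟨ ℚₚ.+-identityʳ (sumTo m f) ⟩
  sumTo m f              ∎
  where open ≡-Reasoning

sumTo-swap : ∀ n m (F : ℕ → ℕ → ℚ) → sumTo n (λ i → sumTo m (F i)) ≡ sumTo m (λ j → sumTo n (λ i → F i j))
sumTo-swap zero    m F = refl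
sumTo-swap (suc n) m F = trans (cong (_+ sumTo m (F (suc n))) (sumTo-swap n m F))
                               (sym (sumTo-distrib-+ m (λ j → sumTo n (λ i → F i j)) (F (suc n))))

sumTo-antidiagonal : ∀ n (F : ℕ → ℕ → ℚ) →
  sumTo n (λ m → sumTo m (λ i → F i (m ∸ i))) ≡ sumTo n (λ i → sumTo (n ∸ i) (F i))
sumTo-antidiagonal zero    F = refl
sumTo-antidiagonal (suc n) F = begin
  sumTo n (λ m → sumTo m (λ i → F i (m ∸ i))) + (B + c)
    ≡⟨ cong (_+ (B + c)) (sumTo-antidiagonal n F) ⟩
  A + (B + c)
    ≡⟨ ℚₚ.+-assoc A B c ⟨
  (A + B) + c
    ≡⟨ cong (_+ c) (sumTo-distrib-+ n _ _) ⟨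
  sumTo n (λ i → sumTo (n ∸ i) (F i) + F i (suc n ∸ i)) + c
    ≡⟨ cong₂ _+_ (sumTo-cong≤ n (λ i i≤n → sym (sumTo-suc∸ (F i) i≤n))) (sumTo-n∸n (F (suc n))) ⟩
  sumTo n (λ i → sumTo (suc n ∸ i) (F i)) + sumTo (suc n ∸ suc n) (F (suc n))
    ∎
  where
  open ≡-Reasoning
  A = sumTo n (λ i → sumTo (n ∸ i) (F i))
  B = sumTo n (λ i → F i (suc n ∸ i))
  c = F (suc n) (n ∸ n)
  sumTo-suc∸ : ∀ {i} (g : ℕ → ℚ) → i ≤ n → sumTo (suc n ∸ i) g ≡ sumTo (n ∸ i) g + g (suc n ∸ i)
  sumTo-suc∸ g i≤n rewrite ℕₚ.+-∸-assoc 1 i≤n = refl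
  sumTo-n∸n : (g : ℕ → ℚ) → g (n ∸ n) ≡ sumTo (n ∸ n) g
  sumTo-n∸n g rewrite ℕₚ.n∸n≡0 n = refl

infix 4 _≐_
_≐_ : Series → Series → Set
f ≐ g = ∀ n → f n ≡ g n

0ₛ 1ₛ : Series
0ₛ _ = 0ℚ
1ₛ   = const 1ℚ

-ₛ_ : Series → Series
(-ₛ f) n = - f n

⊛-cong : ∀ {f f′ g g′} → f ≐ f′ → g ≐ g′ → f ⊛ g ≐ f′ ⊛ g′
⊛-cong f≐f′ g≐g′ n = sumTo-cong n (λ k → cong₂ _*_ (f≐f′ k) (g≐g′ (n ∸ k)))

⊛-comm : ∀ f g → f ⊛ g ≐ g ⊛ f
⊛-comm f g n = begin
  sumTo n (λ k → f k * g (n ∸ k))                ≡⟨ sumTo-reverse n _ ⟩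
  sumTo n (λ k → f (n ∸ k) * g (n ∸ (n ∸ k)))    ≡⟨ sumTo-cong≤ n (λ k k≤n → cong (λ i → f (n ∸ k) * g i) (ℕₚ.m∸[m∸n]≡n k≤n)) ⟩
  sumTo n (λ k → f (n ∸ k) * g k)                ≡⟨ sumTo-cong n (λ k → ℚₚ.*-comm (f (n ∸ k)) (g k)) ⟩
  sumTo n (λ k → g k * f (n ∸ k))                ∎
  where open ≡-Reasoning

⊛-assoc : ∀ f g h → (f ⊛ g) ⊛ h ≐ f ⊛ (g ⊛ h)
⊛-assoc f g h n = begin
  sumTo n (λ m → sumTo m (λ i → f i * g (m ∸ i)) * h (n ∸ m))
    ≡⟨ sumTo-cong n (λ m → *-distribʳ-sumTo m (h (n ∸ m)) _) ⟩
  sumTo n (λ m → sumTo m (λ i → f i * g (m ∸ i) * h (n ∸ m)))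
    ≡⟨ sumTo-cong n (λ m → sumTo-cong≤ m (λ i i≤m → cong (λ m′ → f i * g (m ∸ i) * h (n ∸ m′)) (sym (ℕₚ.m+[n∸m]≡n i≤m)))) ⟩
  sumTo n (λ m → sumTo m (λ i → F i (m ∸ i)))
    ≡⟨ sumTo-antidiagonal n F ⟩
  sumTo n (λ i → sumTo (n ∸ i) (F i))
    ≡⟨ sumTo-cong n (λ i → sumTo-cong (n ∸ i) (λ j →
         trans (ℚₚ.*-assoc (f i) (g j) _) (cong (λ m → f i * (g j * h m)) (sym (ℕₚ.∸-+-assoc n i j))))) ⟩
  sumTo n (λ i → sumTo (n ∸ i) (λ j → f i * (g j * h (n ∸ i ∸ j))))
    ≡⟨ sumTo-cong n (λ i → *-distribˡ-sumTo (n ∸ i) (f i) _) ⟨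
  sumTo n (λ i → f i * sumTo (n ∸ i) (λ j → g j * h (n ∸ i ∸ j)))
    ∎
  where
  open ≡-Reasoning
  F : ℕ → ℕ → ℚ
  F i j = f i * g j * h (n ∸ (i ℕ.+ j))

⊛-distribˡ-⊕ : ∀ f g h → f ⊛ (g ⊕ h) ≐ (f ⊛ g) ⊕ (f ⊛ h)
⊛-distribˡ-⊕ f g h n = trans (sumTo-cong n (λ k → ℚₚ.*-distribˡ-+ (f k) (g (n ∸ k)) (h (n ∸ k)))) (sumTo-distrib-+ n _ _)

⊛-distribʳ-⊕ : ∀ f g h → (g ⊕ h) ⊛ f ≐ (g ⊛ f) ⊕ (h ⊛ f)
⊛-distribʳ-⊕ f g h n = trans (sumTo-cong n (λ k → ℚₚ.*-distribʳ-+ (f (n ∸ k)) (g k) (h k))) (sumTo-distrib-+ n _ _)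

const-⊛ : ∀ a f → const a ⊛ f ≐ scale a f
const-⊛ a f zero    = refl
const-⊛ a f (suc n) = begin
  sumTo (suc n) (λ k → const a k * f (suc n ∸ k))  ≡⟨ sumTo-sucˡ n _ ⟩
  a * f (suc n) + sumTo n (λ k → 0ℚ * f (n ∸ k))    ≡⟨ cong (a * f (suc n) +_) (sumTo-zero n (λ k _ → ℚₚ.*-zeroˡ (f (n ∸ k)))) ⟩
  a * f (suc n) + 0ℚ                               ≡⟨ ℚₚ.+-identityʳ _ ⟩
  a * f (suc n)                                    ∎
  where open ≡-Reasoning

⊛-identityˡ : ∀ f → 1ₛ ⊛ f ≐ f
⊛-identityˡ f n = trans (const-⊛ 1ℚ f n) (ℚₚ.*-identityˡ (f n))

⊛-identityʳ : ∀ f → f ⊛ 1ₛ ≐ f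
⊛-identityʳ f n = trans (⊛-comm f 1ₛ n) (⊛-identityˡ f n)

⊛-⊕-isCommutativeRing : IsCommutativeRing _≐_ _⊕_ _⊛_ -ₛ_ 0ₛ 1ₛ
⊛-⊕-isCommutativeRing = record
  { isRing = record
    { +-isAbelianGroup = Pointwise.isAbelianGroup ℚₚ.+-0-isAbelianGroup
    ; *-cong           = ⊛-cong
    ; *-assoc          = ⊛-assoc
    ; *-identity       = ⊛-identityˡ , ⊛-identityʳ
    ; distrib          = ⊛-distribˡ-⊕ , ⊛-distribʳ-⊕
    }
  ; *-comm = ⊛-comm
  }

⊛-⊕-commutativeRing : CommutativeRing 0ℓ 0ℓ
⊛-⊕-commutativeRing = record { isCommutativeRing = ⊛-⊕-isCommutativeRing }

open CommutativeRing ⊛-⊕-commutativeRing using (setoid)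
  renaming (refl to ≐-refl; sym to ≐-sym; trans to ≐-trans; +-cong to ⊕-cong; -‿cong to -ₛ-cong)

module ≐-Reasoning = SetoidReasoning setoid

⊖-cong : ∀ {f f′ g g′} → f ≐ f′ → g ≐ g′ → f ⊖ g ≐ f′ ⊖ g′
⊖-cong f≐f′ g≐g′ = ⊕-cong f≐f′ (-ₛ-cong g≐g′)

⊕-congˡ : ∀ f {g g′} → g ≐ g′ → f ⊕ g ≐ f ⊕ g′
⊕-congˡ f g≐g′ n = cong (f n +_) (g≐g′ n)

⊕-congʳ : ∀ g {f f′} → f ≐ f′ → f ⊕ g ≐ f′ ⊕ g
⊕-congʳ g f≐f′ n = cong (_+ g n) (f≐f′ n)

⊖-congˡ : ∀ f {g g′} → g ≐ g′ → f ⊖ g ≐ f ⊖ g′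
⊖-congˡ f = ⊖-cong {f} {f} ≐-refl

⊛-congˡ : ∀ f {g g′} → g ≐ g′ → f ⊛ g ≐ f ⊛ g′
⊛-congˡ f = ⊛-cong {f} {f} ≐-refl

⊛-congʳ : ∀ g {f f′} → f ≐ f′ → f ⊛ g ≐ f′ ⊛ g
⊛-congʳ g f≐f′ = ⊛-cong {g = g} {g} f≐f′ ≐-refl

const-homomorphism : CommutativeRing.rawRing ℚₚ.+-*-commutativeRing
                       -Raw-AlmostCommutative⟶ ACR.fromCommutativeRing ⊛-⊕-commutativeRing
const-homomorphism = record
  { ⟦_⟧    = const
  ; +-homo = const-+
  ; *-homo = const-*
  ; -‿homo = const-neg
  ; 0-homo = λ { zero → refl ; (suc _) → refl }
  ; 1-homo = ≐-refl
  }
  where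
  const-+ : ∀ a b → const (a + b) ≐ const a ⊕ const b
  const-+ a b zero    = refl
  const-+ a b (suc n) = sym (ℚₚ.+-identityʳ 0ℚ)
  const-* : ∀ a b → const (a * b) ≐ const a ⊛ const b
  const-* a b zero    = refl
  const-* a b (suc n) = sym (trans (const-⊛ a (const b) (suc n)) (ℚₚ.*-zeroʳ a))
  const-neg : ∀ a → const (- a) ≐ -ₛ const a
  const-neg a zero    = refl
  const-neg a (suc n) = refl

const-≟ : ∀ a b → Maybe (const a ≐ const b)
const-≟ a b = Maybe.map (λ a≡b n → cong (λ c → const c n) a≡b) (dec⇒maybe (a ℚₚ.≟ b))

module ⊛-Solver = RingSolver _ _ const-homomorphism const-≟

spow-cong : ∀ {f g} → f ≐ g → ∀ j → spow f j ≐ spow g j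
spow-cong f≐g zero    = ≐-refl
spow-cong f≐g (suc j) = ⊛-cong f≐g (spow-cong f≐g j)

spow-+ : ∀ f i j → spow f i ⊛ spow f j ≐ spow f (i ℕ.+ j)
spow-+ f zero    j = ⊛-identityˡ (spow f j)
spow-+ f (suc i) j = ≐-trans (⊛-assoc f (spow f i) (spow f j)) (⊛-congˡ f (spow-+ f i j))

spow-scale : ∀ c f j → spow (scale c f) j ≐ scale (c ^ j) (spow f j)
spow-scale c f zero    n = sym (ℚₚ.*-identityˡ _)
spow-scale c f (suc j) n = begin
  (scale c f ⊛ spow (scale c f) j) n
    ≡⟨ ⊛-congˡ (scale c f) (spow-scale c f j) n ⟩
  sumTo n (λ k → c * f k * (c ^ j * spow f j (n ∸ k)))
    ≡⟨ sumTo-cong n (λ k → solve 4 (λ c cʲ x y → c :* x :* (cʲ :* y) := c :* cʲ :* (x :* y)) refl c (c ^ j) (f k) (spow f j (n ∸ k))) ⟩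
  sumTo n (λ k → c ^ suc j * (f k * spow f j (n ∸ k)))
    ≡⟨ *-distribˡ-sumTo n (c ^ suc j) _ ⟨
  scale (c ^ suc j) (spow f (suc j)) n
    ∎
  where
  open ≡-Reasoning
  open +-*-Solver

spow-vanishes : ∀ f → f 0 ≡ 0ℚ → ∀ j n → n < j → spow f j n ≡ 0ℚ
spow-vanishes f f₀≡0 (suc j) n (s≤s n≤j) = sumTo-zero n term≡0
  where
  term≡0 : ∀ k → k ≤ n → f k * spow f j (n ∸ k) ≡ 0ℚ
  term≡0 zero    _      = trans (cong (_* spow f j n) f₀≡0) (ℚₚ.*-zeroˡ (spow f j n))
  term≡0 (suc k) 1+k≤n = trans (cong (f (suc k) *_) (spow-vanishes f f₀≡0 j (n ∸ suc k) n∸[1+k]<j)) (ℚₚ.*-zeroʳ (f (suc k)))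
    where
    n∸[1+k]<j : n ∸ suc k < j
    n∸[1+k]<j = ℕₚ.<-≤-trans (ℕₚ.∸-monoʳ-< {n} {suc k} {0} (s≤s z≤n) 1+k≤n) n≤j

∂ : Series → Series
(∂ f) n = fromℕ (suc n) * f (suc n)

infix 25 t·_
t·_ : Series → Series
(t· f) zero    = 0ℚ
(t· f) (suc n) = f n

∂-cong : ∀ {f g} → f ≐ g → ∂ f ≐ ∂ g
∂-cong f≐g n = cong (fromℕ (suc n) *_) (f≐g (suc n))

∂-const : ∀ a → ∂ (const a) ≐ const 0ℚ
∂-const a zero    = ℚₚ.*-zeroʳ (fromℕ 1)
∂-const a (suc n) = ℚₚ.*-zeroʳ (fromℕ (suc (suc n)))

∂-⊛ : ∀ f g → ∂ (f ⊛ g) ≐ (∂ f ⊛ g) ⊕ (f ⊛ ∂ g)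
∂-⊛ f g n = begin
  fromℕ (suc n) * sumTo (suc n) (λ k → f k * g (suc n ∸ k))  ≡⟨ *-distribˡ-sumTo (suc n) (fromℕ (suc n)) _ ⟩
  sumTo (suc n) (λ k → fromℕ (suc n) * (f k * g (suc n ∸ k))) ≡⟨ sumTo-cong≤ (suc n) split ⟩
  sumTo (suc n) (λ k → A k + B k)                             ≡⟨ sumTo-distrib-+ (suc n) A B ⟩
  sumTo (suc n) A + sumTo (suc n) B                           ≡⟨ cong₂ _+_ ΣA ΣB ⟩
  (∂ f ⊛ g) n + (f ⊛ ∂ g) n                                   ∎
  where
  open ≡-Reasoning
  A B : ℕ → ℚ
  A k = fromℕ k * f k * g (suc n ∸ k)
  B k = f k * (fromℕ (suc n ∸ k) * g (suc n ∸ k))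
  split : ∀ k → k ≤ suc n → fromℕ (suc n) * (f k * g (suc n ∸ k)) ≡ A k + B k
  split k k≤1+n = begin
    fromℕ (suc n) * (f k * g (suc n ∸ k))
      ≡⟨ cong (λ m → fromℕ m * (f k * g (suc n ∸ k))) (ℕₚ.m+[n∸m]≡n k≤1+n) ⟨
    fromℕ (k ℕ.+ (suc n ∸ k)) * (f k * g (suc n ∸ k))
      ≡⟨ cong (_* (f k * g (suc n ∸ k))) (fromℕ-+ k (suc n ∸ k)) ⟩
    (fromℕ k + fromℕ (suc n ∸ k)) * (f k * g (suc n ∸ k))
      ≡⟨ solve 4 (λ a b x y → (a :+ b) :* (x :* y) := a :* x :* y :+ x :* (b :* y)) refl (fromℕ k) (fromℕ (suc n ∸ k)) (f k) (g (suc n ∸ k)) ⟩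
    A k + B k
      ∎
    where open +-*-Solver
  ΣA : sumTo (suc n) A ≡ (∂ f ⊛ g) n
  ΣA = begin
    sumTo (suc n) A                        ≡⟨ sumTo-sucˡ n A ⟩
    0ℚ * f 0 * g (suc n) + (∂ f ⊛ g) n     ≡⟨ cong (_+ (∂ f ⊛ g) n) (trans (cong (_* g (suc n)) (ℚₚ.*-zeroˡ (f 0))) (ℚₚ.*-zeroˡ (g (suc n)))) ⟩
    0ℚ + (∂ f ⊛ g) n                       ≡⟨ ℚₚ.+-identityˡ _ ⟩
    (∂ f ⊛ g) n                            ∎
  ΣB : sumTo (suc n) B ≡ (f ⊛ ∂ g) n
  ΣB = begin
    sumTo n B + B (suc n)  ≡⟨ cong (sumTo n B +_) B[1+n]≡0 ⟩
    sumTo n B + 0ℚ         ≡⟨ ℚₚ.+-identityʳ _ ⟩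
    sumTo n B              ≡⟨ sumTo-cong≤ n (λ k k≤n → cong (λ m → f k * (fromℕ m * g m)) (ℕₚ.+-∸-assoc 1 k≤n)) ⟩
    (f ⊛ ∂ g) n            ∎
    where
    B[1+n]≡0 : B (suc n) ≡ 0ℚ
    B[1+n]≡0 rewrite ℕₚ.n∸n≡0 n = trans (cong (f (suc n) *_) (ℚₚ.*-zeroˡ (g 0))) (ℚₚ.*-zeroʳ (f (suc n)))

t·-cong : ∀ {f g} → f ≐ g → t· f ≐ t· g
t·-cong f≐g zero    = refl
t·-cong f≐g (suc n) = f≐g n

t·-⊛ : ∀ f g → t· (f ⊛ g) ≐ (t· f) ⊛ g
t·-⊛ f g zero    = sym (ℚₚ.*-zeroˡ (g 0))
t·-⊛ f g (suc n) = begin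
  (f ⊛ g) n                                 ≡⟨ ℚₚ.+-identityˡ _ ⟨
  0ℚ + (f ⊛ g) n                            ≡⟨ cong (_+ (f ⊛ g) n) (ℚₚ.*-zeroˡ (g (suc n))) ⟨
  0ℚ * g (suc n) + (f ⊛ g) n                ≡⟨ sumTo-sucˡ n (λ k → (t· f) k * g (suc n ∸ k)) ⟨
  ((t· f) ⊛ g) (suc n)                      ∎
  where open ≡-Reasoning

t·∂ : ∀ f n → (t· (∂ f)) n ≡ fromℕ n * f n
t·∂ f zero    = sym (ℚₚ.*-zeroˡ (f 0))
t·∂ f (suc n) = refl

∂-spow : ∀ f m → ∂ (spow f (suc m)) ≐ const (fromℕ (suc m)) ⊛ (spow f m ⊛ ∂ f)
∂-spow f zero = begin
  ∂ (f ⊛ 1ₛ)                   ≈⟨ ∂-⊛ f 1ₛ ⟩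
  (∂ f ⊛ 1ₛ) ⊕ (f ⊛ ∂ 1ₛ)      ≈⟨ ⊕-congˡ (∂ f ⊛ 1ₛ) (⊛-congˡ f (∂-const 1ℚ)) ⟩
  (∂ f ⊛ 1ₛ) ⊕ (f ⊛ const 0ℚ)  ≈⟨ solve 2 (λ f′ f → f′ :* con 1ℚ :+ f :* con 0ℚ := con 1ℚ :* (con 1ℚ :* f′)) ≐-refl (∂ f) f ⟩
  1ₛ ⊛ (1ₛ ⊛ ∂ f)              ∎
  where
  open ≐-Reasoning
  open ⊛-Solver
∂-spow f (suc m) = begin
  ∂ (f ⊛ fᵐ⁺¹)                                   ≈⟨ ∂-⊛ f fᵐ⁺¹ ⟩
  (∂ f ⊛ fᵐ⁺¹) ⊕ (f ⊛ ∂ fᵐ⁺¹)                    ≈⟨ ⊕-congˡ (∂ f ⊛ fᵐ⁺¹) (⊛-congˡ f (∂-spow f m)) ⟩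
  (∂ f ⊛ (f ⊛ fᵐ)) ⊕ (f ⊛ (m+1 ⊛ (fᵐ ⊛ ∂ f)))
    ≈⟨ solve 4 (λ f′ f fᵐ c → f′ :* (f :* fᵐ) :+ f :* (c :* (fᵐ :* f′)) := (con 1ℚ :+ c) :* ((f :* fᵐ) :* f′))
               ≐-refl (∂ f) f fᵐ m+1 ⟩
  (1ₛ ⊕ m+1) ⊛ (fᵐ⁺¹ ⊛ ∂ f)                      ≈⟨ ⊛-congʳ (fᵐ⁺¹ ⊛ ∂ f) 1+[m+1]≐m+2 ⟩
  const (fromℕ (suc (suc m))) ⊛ (fᵐ⁺¹ ⊛ ∂ f)     ∎
  where
  open ≐-Reasoning
  open ⊛-Solver
  fᵐ = spow f m
  fᵐ⁺¹ = spow f (suc m)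
  m+1 = const (fromℕ (suc m))
  1+[m+1]≐m+2 : 1ₛ ⊕ m+1 ≐ const (fromℕ (suc (suc m)))
  1+[m+1]≐m+2 zero    = sym (fromℕ-suc (suc m))
  1+[m+1]≐m+2 (suc n) = ℚₚ.+-identityʳ 0ℚ

X : Series
X = t· 1ₛ

X⊛≐t· : ∀ f → X ⊛ f ≐ t· f
X⊛≐t· f = ≐-trans (≐-sym (t·-⊛ 1ₛ f)) (t·-cong (⊛-identityˡ f))

⊛-∂-spow : ∀ u f m → u ⊛ ∂ (spow f (suc m)) ≐ const (fromℕ (suc m)) ⊛ (spow f m ⊛ (u ⊛ ∂ f))
⊛-∂-spow u f m = ≐-trans (⊛-congˡ u (∂-spow f m))
  (solve 4 (λ u c fᵐ f′ → u :* (c :* (fᵐ :* f′)) := c :* (fᵐ :* (u :* f′))) ≐-refl u (const (fromℕ (suc m))) (spow f m) (∂ f))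
  where open ⊛-Solver

⊛-∂-spow-of-inverse : ∀ u f → u ⊛ ∂ f ≐ 1ₛ → ∀ m → u ⊛ ∂ (spow f (suc m)) ≐ const (fromℕ (suc m)) ⊛ spow f m
⊛-∂-spow-of-inverse u f u⊛∂f≐1 m = begin
  u ⊛ ∂ (spow f (suc m))            ≈⟨ ⊛-∂-spow u f m ⟩
  c ⊛ (spow f m ⊛ (u ⊛ ∂ f))        ≈⟨ ⊛-congˡ c (⊛-congˡ (spow f m) u⊛∂f≐1) ⟩
  c ⊛ (spow f m ⊛ 1ₛ)               ≈⟨ ⊛-congˡ c (⊛-identityʳ (spow f m)) ⟩
  c ⊛ spow f m                      ∎
  where
  open ≐-Reasoning
  c = const (fromℕ (suc m))

[1+λX]⊛-coefficient : ∀ lam F n → ((1ₛ ⊕ (const lam ⊛ X)) ⊛ F) n ≡ F n + lam * (t· F) n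
[1+λX]⊛-coefficient lam F n = trans (F-form n) (cong (F n +_) (const-⊛ lam (t· F) n))
  where
  open ⊛-Solver
  F-form : (1ₛ ⊕ (const lam ⊛ X)) ⊛ F ≐ F ⊕ (const lam ⊛ (t· F))
  F-form = ≐-trans (solve 3 (λ F c X → (con 1ℚ :+ c :* X) :* F := F :+ c :* (X :* F)) ≐-refl F (const lam) X)
                   (⊕-congˡ F (⊛-congˡ (const lam) (X⊛≐t· F)))

geomSum : Series → ℕ → Series
geomSum g N n = sumTo N (λ j → spow g j n)

geomSum-⊛-[1⊖g] : ∀ g N → geomSum g N ⊛ (1ₛ ⊖ g) ≐ 1ₛ ⊖ spow g (suc N)
geomSum-⊛-[1⊖g] g zero = solve 1 (λ g → con 1ℚ :* (con 1ℚ :- g) := con 1ℚ :- g :* con 1ℚ) ≐-refl g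
  where open ⊛-Solver
geomSum-⊛-[1⊖g] g (suc N) = begin
  (geomSum g N ⊕ gᴺ⁺¹) ⊛ (1ₛ ⊖ g)                 ≈⟨ ⊛-distribʳ-⊕ (1ₛ ⊖ g) (geomSum g N) gᴺ⁺¹ ⟩
  (geomSum g N ⊛ (1ₛ ⊖ g)) ⊕ (gᴺ⁺¹ ⊛ (1ₛ ⊖ g))    ≈⟨ ⊕-congʳ (gᴺ⁺¹ ⊛ (1ₛ ⊖ g)) (geomSum-⊛-[1⊖g] g N) ⟩
  (1ₛ ⊖ gᴺ⁺¹) ⊕ (gᴺ⁺¹ ⊛ (1ₛ ⊖ g))
    ≈⟨ solve 2 (λ g gᴺ⁺¹ → (con 1ℚ :- gᴺ⁺¹) :+ gᴺ⁺¹ :* (con 1ℚ :- g) := con 1ℚ :- g :* gᴺ⁺¹) ≐-refl g gᴺ⁺¹ ⟩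
  1ₛ ⊖ (g ⊛ gᴺ⁺¹)                                 ∎
  where
  open ≐-Reasoning
  open ⊛-Solver
  gᴺ⁺¹ = spow g (suc N)

sgeom-⊛-[1⊖g] : ∀ g → g 0 ≡ 0ℚ → sgeom g ⊛ (1ₛ ⊖ g) ≐ 1ₛ
sgeom-⊛-[1⊖g] g g₀≡0 n = begin
  (sgeom g ⊛ (1ₛ ⊖ g)) n         ≡⟨ sumTo-cong≤ n (λ k k≤n → cong (_* (1ₛ ⊖ g) (n ∸ k)) (sgeom≡geomSum k k≤n)) ⟩
  (geomSum g n ⊛ (1ₛ ⊖ g)) n     ≡⟨ geomSum-⊛-[1⊖g] g n n ⟩
  1ₛ n - spow g (suc n) n        ≡⟨ cong (λ c → 1ₛ n - c) (spow-vanishes g g₀≡0 (suc n) n ℕₚ.≤-refl) ⟩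
  1ₛ n - 0ℚ                      ≡⟨ ℚₚ.+-identityʳ (1ₛ n) ⟩
  1ₛ n                           ∎
  where
  open ≡-Reasoning
  sgeom≡geomSum : ∀ k → k ≤ n → sgeom g k ≡ geomSum g n k
  sgeom≡geomSum k k≤n = sym (sumTo-truncate k n (λ j → spow g j k) k≤n (λ j k<j _ → spow-vanishes g g₀≡0 j k k<j))

sinv-inverseˡ : ∀ h → h 0 ≡ 1ℚ → sinv h ⊛ h ≐ 1ₛ
sinv-inverseˡ h h₀≡1 = ≐-trans (⊛-congˡ (sinv h) h≐1⊖[1⊖h])
  (sgeom-⊛-[1⊖g] (1ₛ ⊖ h) (trans (cong (λ c → 1ℚ - c) h₀≡1) (ℚₚ.+-inverseʳ 1ℚ)))
  where
  open ⊛-Solver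
  h≐1⊖[1⊖h] : h ≐ 1ₛ ⊖ (1ₛ ⊖ h)
  h≐1⊖[1⊖h] = solve 1 (λ h → h := con 1ℚ :- (con 1ℚ :- h)) ≐-refl h

inverse-unique : ∀ u w v → u ⊛ v ≐ 1ₛ → w ⊛ v ≐ 1ₛ → u ≐ w
inverse-unique u w v uv≐1 wv≐1 = begin
  u               ≈⟨ ≐-sym (⊛-identityʳ u) ⟩
  u ⊛ 1ₛ          ≈⟨ ⊛-congˡ u (≐-sym wv≐1) ⟩
  u ⊛ (w ⊛ v)     ≈⟨ solve 3 (λ u w v → u :* (w :* v) := w :* (u :* v)) ≐-refl u w v ⟩
  w ⊛ (u ⊛ v)     ≈⟨ ⊛-congˡ w uv≐1 ⟩
  w ⊛ 1ₛ          ≈⟨ ⊛-identityʳ w ⟩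
  w               ∎
  where
  open ≐-Reasoning
  open ⊛-Solver

sinv-unique : ∀ h u → h 0 ≡ 1ℚ → u ⊛ h ≐ 1ₛ → sinv h ≐ u
sinv-unique h u h₀≡1 = inverse-unique (sinv h) u h (sinv-inverseˡ h h₀≡1)

sinv-cong : ∀ {h h′} → h 0 ≡ 1ℚ → h ≐ h′ → sinv h ≐ sinv h′
sinv-cong {h} {h′} h₀≡1 h≐h′ = ≐-sym (sinv-unique h′ (sinv h) (trans (sym (h≐h′ 0)) h₀≡1)
  (≐-trans (⊛-congˡ (sinv h) (≐-sym h≐h′)) (sinv-inverseˡ h h₀≡1)))

-- The composite f(L(t)); truncating at k ≤ n is only correct when L 0 ≡ 0.
infixl 9 _∘ₛ_
_∘ₛ_ : Series → Series → Series
(f ∘ₛ L) n = sumTo n (λ k → f k * spow L k n)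

∘ₛ-congˡ : ∀ {f g} L → f ≐ g → f ∘ₛ L ≐ g ∘ₛ L
∘ₛ-congˡ L f≐g n = sumTo-cong n (λ k → cong (_* spow L k n) (f≐g k))

∘ₛ-⊖ : ∀ f g L → (f ⊖ g) ∘ₛ L ≐ (f ∘ₛ L) ⊖ (g ∘ₛ L)
∘ₛ-⊖ f g L n = begin
  sumTo n (λ k → (f k - g k) * spow L k n)
    ≡⟨ sumTo-cong n (λ k → trans (ℚₚ.*-distribʳ-+ (spow L k n) (f k) (- g k))
                                 (cong (f k * spow L k n +_) (sym (ℚₚ.neg-distribˡ-* (g k) (spow L k n))))) ⟩
  sumTo n (λ k → f k * spow L k n + - (g k * spow L k n))
    ≡⟨ sumTo-distrib-+ n _ _ ⟩
  (f ∘ₛ L) n + sumTo n (λ k → - (g k * spow L k n))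
    ≡⟨ cong ((f ∘ₛ L) n +_) (sumTo-neg n _) ⟩
  (f ∘ₛ L) n - (g ∘ₛ L) n
    ∎
  where open ≡-Reasoning

∘ₛ-const : ∀ a L → const a ∘ₛ L ≐ const a
∘ₛ-const a L zero    = ℚₚ.*-identityʳ a
∘ₛ-const a L (suc n) = begin
  sumTo (suc n) (λ k → const a k * spow L k (suc n))
    ≡⟨ sumTo-sucˡ n _ ⟩
  a * 0ℚ + sumTo n (λ k → 0ℚ * spow L (suc k) (suc n))
    ≡⟨ cong₂ _+_ (ℚₚ.*-zeroʳ a) (sumTo-zero n (λ k _ → ℚₚ.*-zeroˡ (spow L (suc k) (suc n)))) ⟩
  0ℚ + 0ℚ
    ≡⟨⟩
  0ℚ
    ∎
  where open ≡-Reasoning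

∘ₛ-constant-term : ∀ f L → (f ∘ₛ L) 0 ≡ f 0
∘ₛ-constant-term f L = ℚₚ.*-identityʳ (f 0)

module _ (L : Series) (L₀≡0 : L 0 ≡ 0ℚ) where

  ∘ₛ-truncate : ∀ f {m} N → m ≤ N → (f ∘ₛ L) m ≡ sumTo N (λ i → f i * spow L i m)
  ∘ₛ-truncate f {m} N m≤N = sym (sumTo-truncate m N _ m≤N (λ i m<i _ →
    trans (cong (f i *_) (spow-vanishes L L₀≡0 i m m<i)) (ℚₚ.*-zeroʳ (f i))))

  private
    double-sum : Series → Series → ℕ → ℚ
    double-sum f g n = sumTo n (λ i → sumTo n (λ j → f i * g j * spow L (i ℕ.+ j) n))

    ∘ₛ-⊛-double-sum : ∀ f g n → ((f ⊛ g) ∘ₛ L) n ≡ double-sum f g n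
    ∘ₛ-⊛-double-sum f g n = begin
      sumTo n (λ m → sumTo m (λ i → f i * g (m ∸ i)) * spow L m n)
        ≡⟨ sumTo-cong n (λ m → *-distribʳ-sumTo m (spow L m n) _) ⟩
      sumTo n (λ m → sumTo m (λ i → f i * g (m ∸ i) * spow L m n))
        ≡⟨ sumTo-cong n (λ m → sumTo-cong≤ m (λ i i≤m → cong (λ k → f i * g (m ∸ i) * spow L k n) (sym (ℕₚ.m+[n∸m]≡n i≤m)))) ⟩
      sumTo n (λ m → sumTo m (λ i → F i (m ∸ i)))
        ≡⟨ sumTo-antidiagonal n F ⟩
      sumTo n (λ i → sumTo (n ∸ i) (F i))
        ≡⟨ sumTo-cong≤ n (λ i i≤n → sym (sumTo-truncate (n ∸ i) n (F i) (ℕₚ.m∸n≤m n i) (λ j n∸i<j _ → F≡0 i j i≤n n∸i<j))) ⟩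
      double-sum f g n
        ∎
      where
      open ≡-Reasoning
      F : ℕ → ℕ → ℚ
      F i j = f i * g j * spow L (i ℕ.+ j) n
      F≡0 : ∀ i j → i ≤ n → n ∸ i < j → F i j ≡ 0ℚ
      F≡0 i j i≤n n∸i<j = trans (cong (f i * g j *_) (spow-vanishes L L₀≡0 (i ℕ.+ j) n n<i+j)) (ℚₚ.*-zeroʳ (f i * g j))
        where
        n<i+j : n < i ℕ.+ j
        n<i+j = subst (_< i ℕ.+ j) (ℕₚ.m+[n∸m]≡n i≤n) (ℕₚ.+-monoʳ-< i n∸i<j)

    ⊛-∘ₛ-double-sum : ∀ f g n → ((f ∘ₛ L) ⊛ (g ∘ₛ L)) n ≡ double-sum f g n
    ⊛-∘ₛ-double-sum f g n = begin
      sumTo n (λ m → (f ∘ₛ L) m * (g ∘ₛ L) (n ∸ m))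
        ≡⟨ sumTo-cong≤ n (λ m m≤n → cong₂ _*_ (∘ₛ-truncate f n m≤n) (∘ₛ-truncate g n (ℕₚ.m∸n≤m n m))) ⟩
      sumTo n (λ m → sumTo n (λ i → f i * spow L i m) * sumTo n (λ j → g j * spow L j (n ∸ m)))
        ≡⟨ sumTo-cong n (λ m → sumTo-*-sumTo n n _ _) ⟩
      sumTo n (λ m → sumTo n (λ i → sumTo n (λ j → G i j m)))
        ≡⟨ sumTo-swap n n _ ⟩
      sumTo n (λ i → sumTo n (λ m → sumTo n (λ j → G i j m)))
        ≡⟨ sumTo-cong n (λ i → sumTo-swap n n _) ⟩
      sumTo n (λ i → sumTo n (λ j → sumTo n (G i j)))
        ≡⟨ sumTo-cong n (λ i → sumTo-cong n (λ j → ΣG≡F i j)) ⟩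
      double-sum f g n
        ∎
      where
      open ≡-Reasoning
      G : ℕ → ℕ → ℕ → ℚ
      G i j m = f i * spow L i m * (g j * spow L j (n ∸ m))
      ΣG≡F : ∀ i j → sumTo n (G i j) ≡ f i * g j * spow L (i ℕ.+ j) n
      ΣG≡F i j = begin
        sumTo n (G i j)
          ≡⟨ sumTo-cong n (λ m → solve 4 (λ a b x y → a :* x :* (b :* y) := a :* b :* (x :* y)) refl (f i) (g j) (spow L i m) (spow L j (n ∸ m))) ⟩
        sumTo n (λ m → f i * g j * (spow L i m * spow L j (n ∸ m)))
          ≡⟨ *-distribˡ-sumTo n (f i * g j) _ ⟨
        f i * g j * (spow L i ⊛ spow L j) n
          ≡⟨ cong (f i * g j *_) (spow-+ L i j n) ⟩
        f i * g j * spow L (i ℕ.+ j) n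
          ∎
        where open +-*-Solver

  ∘ₛ-⊛ : ∀ f g → (f ⊛ g) ∘ₛ L ≐ (f ∘ₛ L) ⊛ (g ∘ₛ L)
  ∘ₛ-⊛ f g n = trans (∘ₛ-⊛-double-sum f g n) (sym (⊛-∘ₛ-double-sum f g n))

  ∘ₛ-sinv : ∀ h → h 0 ≡ 1ℚ → sinv h ∘ₛ L ≐ sinv (h ∘ₛ L)
  ∘ₛ-sinv h h₀≡1 = ≐-sym (sinv-unique (h ∘ₛ L) (sinv h ∘ₛ L) (trans (∘ₛ-constant-term h L) h₀≡1) (begin
    (sinv h ∘ₛ L) ⊛ (h ∘ₛ L)  ≈⟨ ≐-sym (∘ₛ-⊛ (sinv h) h) ⟩
    (sinv h ⊛ h) ∘ₛ L         ≈⟨ ∘ₛ-congˡ L (sinv-inverseˡ h h₀≡1) ⟩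
    1ₛ ∘ₛ L                   ≈⟨ ∘ₛ-const 1ℚ L ⟩
    1ₛ                        ∎))
    where open ≐-Reasoning

monomial : ℚ → ℕ → Series
monomial c zero    = const c
monomial c (suc j) = t· monomial c j

monomial-diagonal : ∀ c j → monomial c j j ≡ c
monomial-diagonal c zero    = refl
monomial-diagonal c (suc j) = monomial-diagonal c j

monomial-above : ∀ c j k → j < k → monomial c j k ≡ 0ℚ
monomial-above c zero    (suc k) _         = refl
monomial-above c (suc j) (suc k) (s≤s j<k) = monomial-above c j k j<k

scale-monomial : ∀ a c j → scale a (monomial c j) ≐ monomial (a * c) j
scale-monomial a c zero    zero    = refl
scale-monomial a c zero    (suc k) = ℚₚ.*-zeroʳ a
scale-monomial a c (suc j) zero    = ℚₚ.*-zeroʳ a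
scale-monomial a c (suc j) (suc k) = scale-monomial a c j k

spow-monomial : ∀ a j → spow (monomial a 1) j ≐ monomial (a ^ j) j
spow-monomial a zero    = ≐-refl
spow-monomial a (suc j) = begin
  (t· const a) ⊛ spow (monomial a 1) j   ≈⟨ ⊛-congˡ (t· const a) (spow-monomial a j) ⟩
  (t· const a) ⊛ monomial (a ^ j) j      ≈⟨ ≐-sym (t·-⊛ (const a) (monomial (a ^ j) j)) ⟩
  t· (const a ⊛ monomial (a ^ j) j)      ≈⟨ t·-cong (const-⊛ a (monomial (a ^ j) j)) ⟩
  t· scale a (monomial (a ^ j) j)        ≈⟨ t·-cong (scale-monomial a (a ^ j) j) ⟩
  monomial (a ^ suc j) (suc j)           ∎
  where open ≐-Reasoning

sexp-cong : ∀ {f g} → f ≐ g → sexp f ≐ sexp g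
sexp-cong f≐g n = sumTo-cong n (λ j → cong (invFact j *_) (spow-cong f≐g j n))

expLin-coefficient : ∀ a k → expLin a k ≡ a ^ k * invFact k
expLin-coefficient a k = trans (sexp-cong {g = monomial a 1} (λ { 0 → refl ; 1 → refl ; (suc (suc _)) → refl }) k) (sexp-monomial k)
  where
  sexp-monomial : ∀ k → sexp (monomial a 1) k ≡ a ^ k * invFact k
  sexp-monomial zero    = ℚₚ.*-comm (invFact 0) 1ℚ
  sexp-monomial (suc k) = begin
    sumTo k (λ j → invFact j * spow (monomial a 1) j (suc k)) + invFact (suc k) * spow (monomial a 1) (suc k) (suc k)
      ≡⟨ cong₂ _+_ (sumTo-zero k below-diagonal≡0) (cong (invFact (suc k) *_) diagonal) ⟩
    0ℚ + invFact (suc k) * a ^ suc k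
      ≡⟨ ℚₚ.+-identityˡ _ ⟩
    invFact (suc k) * a ^ suc k
      ≡⟨ ℚₚ.*-comm (invFact (suc k)) (a ^ suc k) ⟩
    a ^ suc k * invFact (suc k)
      ∎
    where
    open ≡-Reasoning
    below-diagonal≡0 : ∀ j → j ≤ k → invFact j * spow (monomial a 1) j (suc k) ≡ 0ℚ
    below-diagonal≡0 j j≤k = trans (cong (invFact j *_) (trans (spow-monomial a j (suc k)) (monomial-above (a ^ j) j (suc k) (s≤s j≤k))))
                                   (ℚₚ.*-zeroʳ (invFact j))
    diagonal : spow (monomial a 1) (suc k) (suc k) ≡ a ^ suc k
    diagonal = trans (spow-monomial a (suc k) (suc k)) (monomial-diagonal (a ^ suc k) (suc k))

expLin-0 : expLin 0ℚ ≐ 1ₛ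
expLin-0 zero    = refl
expLin-0 (suc k) = trans (expLin-coefficient 0ℚ (suc k))
  (trans (cong (_* invFact (suc k)) (ℚₚ.*-zeroˡ (0ℚ ^ k))) (ℚₚ.*-zeroˡ (invFact (suc k))))

sexp-scale : ∀ a L → sexp (scale a L) ≐ expLin a ∘ₛ L
sexp-scale a L n = sumTo-cong n (λ j → begin
  invFact j * spow (scale a L) j n   ≡⟨ cong (invFact j *_) (spow-scale a L j n) ⟩
  invFact j * (a ^ j * spow L j n)   ≡⟨ solve 3 (λ i aʲ x → i :* (aʲ :* x) := aʲ :* i :* x) refl (invFact j) (a ^ j) (spow L j n) ⟩
  a ^ j * invFact j * spow L j n     ≡⟨ cong (_* spow L j n) (expLin-coefficient a j) ⟨
  expLin a j * spow L j n            ∎)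
  where
  open ≡-Reasoning
  open +-*-Solver

[eᵗ-1]/t : Series
[eᵗ-1]/t k = invFact (suc k)

bernGen⊛[eᵗ-1]/t≐1 : bernGen ⊛ [eᵗ-1]/t ≐ 1ₛ
bernGen⊛[eᵗ-1]/t≐1 = sinv-inverseˡ [eᵗ-1]/t refl

X⊛∂[eᵗ-1]/t : X ⊛ ∂ [eᵗ-1]/t ≐ (1ₛ ⊕ (X ⊛ [eᵗ-1]/t)) ⊖ [eᵗ-1]/t
X⊛∂[eᵗ-1]/t = ≐-trans (X⊛≐t· (∂ h)) (≐-trans ode (⊖-cong (⊕-congˡ 1ₛ (≐-sym (X⊛≐t· h))) ≐-refl))
  where
  h = [eᵗ-1]/t
  ode : t· ∂ h ≐ (1ₛ ⊕ (t· h)) ⊖ h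
  ode zero    = refl
  ode (suc n) = begin
    fromℕ (suc n) * I′                ≡⟨ solve 2 (λ N I′ → N :* I′ := (con 1ℚ :+ N) :* I′ :- I′) refl (fromℕ (suc n)) I′ ⟩
    (1ℚ + fromℕ (suc n)) * I′ - I′    ≡⟨ cong (λ a → a * I′ - I′) (fromℕ-suc (suc n)) ⟨
    fromℕ (suc (suc n)) * I′ - I′     ≡⟨ cong (_- I′) ([n+1]*invFact[n+1]≡invFact[n] (suc n)) ⟩
    invFact (suc n) - I′              ≡⟨ cong (_- I′) (ℚₚ.+-identityˡ (invFact (suc n))) ⟨
    (0ℚ + invFact (suc n)) - I′       ∎
    where
    open ≡-Reasoning
    open +-*-Solver
    I′ = invFact (suc (suc n))

X⊛∂bernGen : X ⊛ ∂ bernGen ≐ (bernGen ⊖ (bernGen ⊛ bernGen)) ⊖ (X ⊛ bernGen)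
X⊛∂bernGen = begin
  X ⊛ ∂ β
    ≈⟨ ⊛-identityʳ (X ⊛ ∂ β) ⟨
  (X ⊛ ∂ β) ⊛ 1ₛ
    ≈⟨ ⊛-congˡ (X ⊛ ∂ β) h⊛β≐1 ⟨
  (X ⊛ ∂ β) ⊛ (h ⊛ β)
    ≈⟨ solve 5 (λ X β β′ h h′ → (X :* β′) :* (h :* β) := (X :* (β′ :* h :+ β :* h′)) :* β :- (β :* (X :* h′)) :* β)
             ≐-refl X β (∂ β) h (∂ h) ⟩
  ((X ⊛ ((∂ β ⊛ h) ⊕ (β ⊛ ∂ h))) ⊛ β) ⊖ ((β ⊛ (X ⊛ ∂ h)) ⊛ β)
    ≈⟨ ⊖-cong (⊛-congʳ β (⊛-congˡ X ∂[β⊛h]≐0)) (⊛-congʳ β (⊛-congˡ β X⊛∂[eᵗ-1]/t)) ⟩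
  ((X ⊛ const 0ℚ) ⊛ β) ⊖ ((β ⊛ ((1ₛ ⊕ (X ⊛ h)) ⊖ h)) ⊛ β)
    ≈⟨ solve 3 (λ X β h → (X :* con 0ℚ) :* β :- (β :* ((con 1ℚ :+ X :* h) :- h)) :* β := ((h :* β) :* β :- β :* β) :- (X :* (h :* β)) :* β)
             ≐-refl X β h ⟩
  (((h ⊛ β) ⊛ β) ⊖ (β ⊛ β)) ⊖ ((X ⊛ (h ⊛ β)) ⊛ β)
    ≈⟨ ⊖-cong (⊖-cong (⊛-congʳ β h⊛β≐1) ≐-refl) (⊛-congʳ β (⊛-congˡ X h⊛β≐1)) ⟩
  ((1ₛ ⊛ β) ⊖ (β ⊛ β)) ⊖ ((X ⊛ 1ₛ) ⊛ β)
    ≈⟨ solve 2 (λ X β → (con 1ℚ :* β :- β :* β) :- (X :* con 1ℚ) :* β := (β :- β :* β) :- X :* β) ≐-refl X β ⟩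
  (β ⊖ (β ⊛ β)) ⊖ (X ⊛ β)
    ∎
  where
  open ≐-Reasoning
  open ⊛-Solver
  β = bernGen
  h = [eᵗ-1]/t
  h⊛β≐1 : h ⊛ β ≐ 1ₛ
  h⊛β≐1 = ≐-trans (⊛-comm h β) bernGen⊛[eᵗ-1]/t≐1
  ∂[β⊛h]≐0 : (∂ β ⊛ h) ⊕ (β ⊛ ∂ h) ≐ const 0ℚ
  ∂[β⊛h]≐0 = ≐-trans (≐-sym (∂-⊛ β h)) (≐-trans (∂-cong bernGen⊛[eᵗ-1]/t≐1) (∂-const 1ℚ))

X⊛∂-spow-bernGen : ∀ m → let B = spow bernGen (suc m) in
  X ⊛ ∂ B ≐ const (fromℕ (suc m)) ⊛ ((B ⊖ (bernGen ⊛ B)) ⊖ (t· B))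
X⊛∂-spow-bernGen m = begin
  X ⊛ ∂ (β ⊛ βᵐ)
    ≈⟨ ⊛-∂-spow X β m ⟩
  c ⊛ (βᵐ ⊛ (X ⊛ ∂ β))
    ≈⟨ ⊛-congˡ c (⊛-congˡ βᵐ X⊛∂bernGen) ⟩
  c ⊛ (βᵐ ⊛ ((β ⊖ (β ⊛ β)) ⊖ (X ⊛ β)))
    ≈⟨ solve 4 (λ c βᵐ β X → c :* (βᵐ :* ((β :- β :* β) :- X :* β)) := c :* ((β :* βᵐ :- β :* (β :* βᵐ)) :- X :* (β :* βᵐ)))
               ≐-refl c βᵐ β X ⟩
  c ⊛ (((β ⊛ βᵐ) ⊖ (β ⊛ (β ⊛ βᵐ))) ⊖ (X ⊛ (β ⊛ βᵐ)))
    ≈⟨ ⊛-congˡ c (⊖-congˡ ((β ⊛ βᵐ) ⊖ (β ⊛ (β ⊛ βᵐ))) (X⊛≐t· (β ⊛ βᵐ))) ⟩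
  c ⊛ (((β ⊛ βᵐ) ⊖ (β ⊛ (β ⊛ βᵐ))) ⊖ (t· (β ⊛ βᵐ)))
    ∎
  where
  open ≐-Reasoning
  open ⊛-Solver
  β = bernGen
  βᵐ = spow β m
  c = const (fromℕ (suc m))

bernGen-spow-recurrence : ∀ m j → let B = spow bernGen (suc m) in
  fromℕ j * B j ≡ fromℕ (suc m) * ((B j - spow bernGen (suc (suc m)) j) - (t· B) j)
bernGen-spow-recurrence m j = begin
  fromℕ j * B j       ≡⟨ t·∂ B j ⟨
  (t· ∂ B) j          ≡⟨ X⊛≐t· (∂ B) j ⟨
  (X ⊛ ∂ B) j         ≡⟨ X⊛∂-spow-bernGen m j ⟩
  (const (fromℕ (suc m)) ⊛ ((B ⊖ (bernGen ⊛ B)) ⊖ (t· B))) j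
                      ≡⟨ const-⊛ (fromℕ (suc m)) ((B ⊖ (bernGen ⊛ B)) ⊖ (t· B)) j ⟩
  fromℕ (suc m) * ((B j - (bernGen ⊛ B) j) - (t· B) j) ∎
  where
  open ≡-Reasoning
  B = spow bernGen (suc m)

orderedBellGen : Series
orderedBellGen = sinv (const (fromℕ 2) ⊖ expLin 1ℚ)

orderedBellNum-egf : ∀ i → orderedBellNum i ≡ fromℕ (i !) * orderedBellGen i
orderedBellNum-egf i = cong (fromℕ (i !) *_) (trans (⊛-congˡ orderedBellGen expLin-0 i) (⊛-identityʳ orderedBellGen i))

orderedBell-binomial : ∀ N x → orderedBell N x ≡ sumTo N (λ i → fromℕ (N C i) * orderedBellNum i * (x ^ (N ∸ i)))
orderedBell-binomial N x = trans (*-distribˡ-sumTo N (fromℕ (N !)) _) (sumTo-cong≤ N term)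
  where
  open +-*-Solver
  term : ∀ i → i ≤ N → fromℕ (N !) * (orderedBellGen i * expLin x (N ∸ i)) ≡ fromℕ (N C i) * orderedBellNum i * (x ^ (N ∸ i))
  term i i≤N = begin
    fromℕ (N !) * (b i * expLin x (N ∸ i))
      ≡⟨ cong₂ (λ a e → a * (b i * e)) (sym (nCk*[k!*[n∸k]!]≡n! i≤N)) (expLin-coefficient x (N ∸ i)) ⟩
    fromℕ (N C i) * (fromℕ (i !) * fromℕ ((N ∸ i) !)) * (b i * (x ^ (N ∸ i) * invFact (N ∸ i)))
      ≡⟨ solve 6 (λ C i! r! b xʳ I → C :* (i! :* r!) :* (b :* (xʳ :* I)) := C :* (i! :* b) :* xʳ :* (r! :* I))
                 refl (fromℕ (N C i)) (fromℕ (i !)) (fromℕ ((N ∸ i) !)) (b i) (x ^ (N ∸ i)) (invFact (N ∸ i)) ⟩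
    fromℕ (N C i) * (fromℕ (i !) * b i) * x ^ (N ∸ i) * (fromℕ ((N ∸ i) !) * invFact (N ∸ i))
      ≡⟨ cong₂ (λ a e → fromℕ (N C i) * a * x ^ (N ∸ i) * e) (sym (orderedBellNum-egf i)) (n!*invFact[n]≡1 (N ∸ i)) ⟩
    fromℕ (N C i) * orderedBellNum i * x ^ (N ∸ i) * 1ℚ
      ≡⟨ ℚₚ.*-identityʳ _ ⟩
    fromℕ (N C i) * orderedBellNum i * (x ^ (N ∸ i))
      ∎
    where
    open ≡-Reasoning
    b = orderedBellGen

-- The inductive step of the Lagrange relation below, with N = j + k, N′ = N + 1, k′ = k + 1 and
-- a, b, d, c, c′, s the coefficients [t^{N+1}] L^{k+1}, [t^N] L^k, [t^N] L^{k+1}, [t^j] β^N,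
-- [t^j] β^{N+1}, [t^{j-1}] β^N.
private
  power-step-algebra : ∀ {ℓ N N′ j k k′ ℓʲ a b d c c′ s} →
    N ≡ j + k → N′ ≡ 1ℚ + N → k′ ≡ 1ℚ + k →
    N′ * a + ℓ * (N * d) ≡ k′ * b →
    N * b ≡ k * (ℓʲ * c) →
    ℓ * (N * d) ≡ k′ * (ℓʲ * s) →
    j * c ≡ N * ((c - c′) - s) →
    N * (N′ * a) ≡ N * (k′ * (ℓʲ * c′))
  power-step-algebra {ℓ} {j = j} {k} {ℓʲ = ℓʲ} {a} {b} {d} {c} {c′} {s} refl refl refl rec-L ih₁ ih₂ rec-β = begin
    N * ((1ℚ + N) * a)
      ≡⟨ solve 4 (λ N a ℓ d → N :* ((con 1ℚ :+ N) :* a) := N :* (((con 1ℚ :+ N) :* a :+ ℓ :* (N :* d)) :- ℓ :* (N :* d)))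
                 refl N a ℓ d ⟩
    N * (((1ℚ + N) * a + ℓ * (N * d)) - ℓ * (N * d))
      ≡⟨ cong (λ x → N * (x - ℓ * (N * d))) rec-L ⟩
    N * ((1ℚ + k) * b - ℓ * (N * d))
      ≡⟨ solve 5 (λ N k b ℓ d → N :* ((con 1ℚ :+ k) :* b :- ℓ :* (N :* d)) := (con 1ℚ :+ k) :* (N :* b) :- N :* (ℓ :* (N :* d)))
                 refl N k b ℓ d ⟩
    (1ℚ + k) * (N * b) - N * (ℓ * (N * d))
      ≡⟨ cong₂ (λ x y → (1ℚ + k) * x - N * y) ih₁ ih₂ ⟩
    (1ℚ + k) * (k * (ℓʲ * c)) - N * ((1ℚ + k) * (ℓʲ * s))
      ≡⟨ solve 5 (λ j k ℓʲ c s → (con 1ℚ :+ k) :* (k :* (ℓʲ :* c)) :- (j :+ k) :* ((con 1ℚ :+ k) :* (ℓʲ :* s))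
                                  := (con 1ℚ :+ k) :* ℓʲ :* (((j :+ k) :* c :- (j :+ k) :* s) :- j :* c)) refl j k ℓʲ c s ⟩
    (1ℚ + k) * ℓʲ * ((N * c - N * s) - j * c)
      ≡⟨ cong (λ x → (1ℚ + k) * ℓʲ * ((N * c - N * s) - x)) rec-β ⟩
    (1ℚ + k) * ℓʲ * ((N * c - N * s) - N * ((c - c′) - s))
      ≡⟨ solve 6 (λ N k ℓʲ c c′ s → (con 1ℚ :+ k) :* ℓʲ :* ((N :* c :- N :* s) :- N :* ((c :- c′) :- s))
                                    := N :* ((con 1ℚ :+ k) :* (ℓʲ :* c′))) refl N k ℓʲ c c′ s ⟩
    N * ((1ℚ + k) * (ℓʲ * c′))
      ∎
    where
    open ≡-Reasoning
    open +-*-Solver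
    N = j + k

module _ (lam : ℚ) .{{_ : NonZero lam}} where

  degLog : Series
  degLog = scale (1/ lam) (log1p lam)

  private
    L = degLog
    β = bernGen

  degLog-constant-term : degLog 0 ≡ 0ℚ
  degLog-constant-term = ℚₚ.*-zeroʳ (1/ lam)

  degExp≐expLin∘ₛdegLog : ∀ a → degExp lam a ≐ expLin a ∘ₛ degLog
  degExp≐expLin∘ₛdegLog a = ≐-trans (sexp-cong (λ n → ℚₚ.*-assoc a (1/ lam) (log1p lam n))) (sexp-scale a degLog)

  ∂degLog-coefficient : ∀ n → ∂ L n ≡ (- 1ℚ) ^ n * lam ^ n
  ∂degLog-coefficient n = begin
    fromℕ (suc n) * (1/ lam * ((- 1ℚ) ^ n * (lam * lam ^ n) * i))
      ≡⟨ solve 6 (λ N μ s l lⁿ i → N :* (μ :* (s :* (l :* lⁿ) :* i)) := (N :* i) :* (μ :* l) :* (s :* lⁿ))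
                 refl (fromℕ (suc n)) (1/ lam) ((- 1ℚ) ^ n) lam (lam ^ n) i ⟩
    (fromℕ (suc n) * i) * (1/ lam * lam) * ((- 1ℚ) ^ n * lam ^ n)
      ≡⟨ cong₂ (λ a b → a * b * ((- 1ℚ) ^ n * lam ^ n)) (fromℕ-*-inverseʳ (suc n)) (ℚₚ.*-inverseˡ lam) ⟩
    1ℚ * 1ℚ * ((- 1ℚ) ^ n * lam ^ n)
      ≡⟨ ℚₚ.*-identityˡ _ ⟩
    (- 1ℚ) ^ n * lam ^ n
      ∎
    where
    open ≡-Reasoning
    open +-*-Solver
    i = (ℤ.+ 1) / suc n

  [1+λX]⊛∂degLog≐1 : (1ₛ ⊕ (const lam ⊛ X)) ⊛ ∂ L ≐ 1ₛ
  [1+λX]⊛∂degLog≐1 n = trans ([1+λX]⊛-coefficient lam (∂ L) n) (ode n)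
    where
    open ≡-Reasoning
    open +-*-Solver
    ode : ∀ n → ∂ L n + lam * (t· ∂ L) n ≡ 1ₛ n
    ode zero = begin
      ∂ L 0 + lam * 0ℚ        ≡⟨ cong (_+ lam * 0ℚ) (∂degLog-coefficient 0) ⟩
      1ℚ * 1ℚ + lam * 0ℚ      ≡⟨ solve 1 (λ l → con 1ℚ :* con 1ℚ :+ l :* con 0ℚ := con 1ℚ) refl lam ⟩
      1ℚ                      ∎
    ode (suc n) = begin
      ∂ L (suc n) + lam * ∂ L n
        ≡⟨ cong₂ (λ a b → a + lam * b) (∂degLog-coefficient (suc n)) (∂degLog-coefficient n) ⟩
      (- 1ℚ) * (- 1ℚ) ^ n * (lam * lam ^ n) + lam * ((- 1ℚ) ^ n * lam ^ n)
        ≡⟨ solve 3 (λ s l lⁿ → (:- con 1ℚ) :* s :* (l :* lⁿ) :+ l :* (s :* lⁿ) := con 0ℚ) refl ((- 1ℚ) ^ n) lam (lam ^ n) ⟩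
      0ℚ
        ∎

  degLog-spow-recurrence : ∀ m n →
    fromℕ (suc n) * spow L (suc m) (suc n) + lam * (fromℕ n * spow L (suc m) n) ≡ fromℕ (suc m) * spow L m n
  degLog-spow-recurrence m n = begin
    fromℕ (suc n) * Lᵐ⁺¹ (suc n) + lam * (fromℕ n * Lᵐ⁺¹ n)  ≡⟨ cong (λ a → ∂ Lᵐ⁺¹ n + lam * a) (t·∂ Lᵐ⁺¹ n) ⟨
    ∂ Lᵐ⁺¹ n + lam * (t· ∂ Lᵐ⁺¹) n                          ≡⟨ [1+λX]⊛-coefficient lam (∂ Lᵐ⁺¹) n ⟨
    ((1ₛ ⊕ (const lam ⊛ X)) ⊛ ∂ Lᵐ⁺¹) n                     ≡⟨ ⊛-∂-spow-of-inverse (1ₛ ⊕ (const lam ⊛ X)) L [1+λX]⊛∂degLog≐1 m n ⟩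
    (const (fromℕ (suc m)) ⊛ spow L m) n                    ≡⟨ const-⊛ (fromℕ (suc m)) (spow L m) n ⟩
    fromℕ (suc m) * spow L m n                              ∎
    where
    open ≡-Reasoning
    Lᵐ⁺¹ = spow L (suc m)

  -- For n = j + k this is the Lagrange inversion formula n [tⁿ] Lᵏ = k λʲ [tʲ] βⁿ.
  PowerCoefficientRelation : ℕ → ℕ → ℕ → Set
  PowerCoefficientRelation j k n = fromℕ n * spow L k n ≡ fromℕ k * (lam ^ j * spow β n j)

  -- The last hypothesis is λ times the relation at (j - 1, k + 1); for j = 0 it reads 0 = 0.
  private
    power-coefficient-step : ∀ j k n → fromℕ (suc n) ≡ fromℕ j + fromℕ k →
      PowerCoefficientRelation j k (suc n) →
      lam * (fromℕ (suc n) * spow L (suc k) (suc n)) ≡ fromℕ (suc k) * (lam ^ j * (t· spow β (suc n)) j) →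
      PowerCoefficientRelation j (suc k) (suc (suc n))
    power-coefficient-step j k n N≡j+k ih₁ ih₂ = *-cancelˡ-fromℕ (suc n)
      (power-step-algebra {lam} {j = fromℕ j} {fromℕ k} {ℓʲ = lam ^ j} N≡j+k (fromℕ-suc (suc n)) (fromℕ-suc k)
        (degLog-spow-recurrence k (suc n)) ih₁ ih₂ (bernGen-spow-recurrence n j))

  power-coefficient-relation : ∀ j k → PowerCoefficientRelation j k (j ℕ.+ k)
  power-coefficient-relation j zero rewrite ℕₚ.+-identityʳ j =
    trans (lhs≡0 j) (sym (ℚₚ.*-zeroˡ (lam ^ j * spow β j j)))
    where
    lhs≡0 : ∀ j → fromℕ j * const 1ℚ j ≡ 0ℚ
    lhs≡0 zero    = refl
    lhs≡0 (suc j) = ℚₚ.*-zeroʳ (fromℕ (suc j))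
  power-coefficient-relation zero (suc zero) = begin
    fromℕ 1 * spow L 1 1  ≡⟨ cong (fromℕ 1 *_) (⊛-identityʳ L 1) ⟩
    fromℕ 1 * L 1         ≡⟨ ∂degLog-coefficient 0 ⟩
    1ℚ * 1ℚ               ≡⟨⟩
    fromℕ 1 * (lam ^ 0 * spow β 1 0) ∎
    where open ≡-Reasoning
  power-coefficient-relation zero (suc (suc k)) =
    power-coefficient-step 0 (suc k) k (fromℕ-+ 0 (suc k)) (power-coefficient-relation 0 (suc k)) (trans lhs≡0 (sym rhs≡0))
    where
    lhs≡0 : lam * (fromℕ (suc k) * spow L (suc (suc k)) (suc k)) ≡ 0ℚ
    lhs≡0 = trans (cong (λ x → lam * (fromℕ (suc k) * x)) (spow-vanishes L degLog-constant-term (suc (suc k)) (suc k) ℕₚ.≤-refl))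
                  (trans (cong (lam *_) (ℚₚ.*-zeroʳ (fromℕ (suc k)))) (ℚₚ.*-zeroʳ lam))
    rhs≡0 : fromℕ (suc (suc k)) * (lam ^ 0 * 0ℚ) ≡ 0ℚ
    rhs≡0 = ℚₚ.*-zeroʳ (fromℕ (suc (suc k)))
  power-coefficient-relation (suc j) (suc k) =
    subst (PowerCoefficientRelation (suc j) (suc k)) (cong suc (sym (ℕₚ.+-suc j k)))
    (power-coefficient-step (suc j) k (j ℕ.+ k) (fromℕ-+ (suc j) k) (power-coefficient-relation (suc j) k) ih₂)
    where
    N = suc (j ℕ.+ k)
    ih : PowerCoefficientRelation j (suc k) N
    ih = subst (PowerCoefficientRelation j (suc k)) (ℕₚ.+-suc j k) (power-coefficient-relation j (suc k))
    ih₂ : lam * (fromℕ N * spow L (suc k) N) ≡ fromℕ (suc k) * (lam ^ suc j * spow β N j)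
    ih₂ = trans (cong (lam *_) ih)
      (solve 4 (λ ℓ K ℓʲ c → ℓ :* (K :* (ℓʲ :* c)) := K :* ((ℓ :* ℓʲ) :* c)) refl lam (fromℕ (suc k)) (lam ^ j) (spow β N j))
      where open +-*-Solver

  degOrderedBellGen≐orderedBellGen∘ₛdegLog : ∀ x →
    sinv (const (fromℕ 2) ⊖ degExp lam 1ℚ) ⊛ degExp lam x ≐ (orderedBellGen ⊛ expLin x) ∘ₛ L
  degOrderedBellGen≐orderedBellGen∘ₛdegLog x = begin
    sinv (const (fromℕ 2) ⊖ degExp lam 1ℚ) ⊛ degExp lam x
      ≈⟨ ⊛-cong (sinv-cong refl 2⊖degExp≐H∘ₛL) (degExp≐expLin∘ₛdegLog x) ⟩
    sinv (H ∘ₛ L) ⊛ (expLin x ∘ₛ L)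
      ≈⟨ ⊛-congʳ (expLin x ∘ₛ L) (∘ₛ-sinv L degLog-constant-term H refl) ⟨
    (sinv H ∘ₛ L) ⊛ (expLin x ∘ₛ L)
      ≈⟨ ∘ₛ-⊛ L degLog-constant-term (sinv H) (expLin x) ⟨
    (orderedBellGen ⊛ expLin x) ∘ₛ L
      ∎
    where
    open ≐-Reasoning
    H = const (fromℕ 2) ⊖ expLin 1ℚ
    2⊖degExp≐H∘ₛL : const (fromℕ 2) ⊖ degExp lam 1ℚ ≐ H ∘ₛ L
    2⊖degExp≐H∘ₛL = ≐-trans (⊖-cong (≐-sym (∘ₛ-const (fromℕ 2) L)) (degExp≐expLin∘ₛdegLog 1ℚ))
                            (≐-sym (∘ₛ-⊖ (const (fromℕ 2)) (expLin 1ℚ) L))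

  degOrderedBell-term : ∀ x m l → l ≤ m →
    fromℕ (suc m !) * ((orderedBellGen ⊛ expLin x) (suc m ∸ l) * spow L (suc m ∸ l) (suc m))
      ≡ lam ^ l * fromℕ (m C l) * higherBernoulli (suc m) l * orderedBell (suc m ∸ l) x
  degOrderedBell-term x m l l≤m rewrite ℕₚ.+-∸-assoc 1 l≤m = begin
    fromℕ (suc m !) * (q * Lᵏ)      ≡⟨ cong (_* (q * Lᵏ)) (fromℕ-* (suc m) (m !)) ⟩
    N * m! * (q * Lᵏ)               ≡⟨ solve 4 (λ N m! q Lᵏ → N :* m! :* (q :* Lᵏ) := m! :* q :* (N :* Lᵏ)) refl N m! q Lᵏ ⟩
    m! * q * (N * Lᵏ)               ≡⟨ cong (m! * q *_) coefficient ⟩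
    m! * q * (K * (ℓˡ * c))         ≡⟨ solve 5 (λ m! q K ℓˡ c → m! :* q :* (K :* (ℓˡ :* c)) := ℓˡ :* c :* q :* (m! :* K)) refl m! q K ℓˡ c ⟩
    ℓˡ * c * q * (m! * K)           ≡⟨ cong (ℓˡ * c * q *_) m!*K≡Cₘₗ*l!*k! ⟩
    ℓˡ * c * q * (Cₘₗ * l! * k!)    ≡⟨ solve 6 (λ ℓˡ c q C l! k! → ℓˡ :* c :* q :* (C :* l! :* k!) := ℓˡ :* C :* (l! :* c) :* (k! :* q))
                                               refl ℓˡ c q Cₘₗ l! k! ⟩
    ℓˡ * Cₘₗ * (l! * c) * (k! * q)  ∎
    where
    open ≡-Reasoning
    open +-*-Solver
    r = m ∸ l
    k = suc r
    q = (orderedBellGen ⊛ expLin x) k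
    Lᵏ = spow L k (suc m)
    c = spow bernGen (suc m) l
    N = fromℕ (suc m)
    K = fromℕ k
    ℓˡ = lam ^ l
    m! = fromℕ (m !)
    l! = fromℕ (l !)
    k! = fromℕ (k !)
    r! = fromℕ (r !)
    Cₘₗ = fromℕ (m C l)
    coefficient : N * Lᵏ ≡ K * (ℓˡ * c)
    coefficient = subst (PowerCoefficientRelation l k) (trans (ℕₚ.+-suc l r) (cong suc (ℕₚ.m+[n∸m]≡n l≤m)))
                        (power-coefficient-relation l k)
    m!*K≡Cₘₗ*l!*k! : m! * K ≡ Cₘₗ * l! * k!
    m!*K≡Cₘₗ*l!*k! = begin
      m! * K                 ≡⟨ cong (_* K) (nCk*[k!*[n∸k]!]≡n! l≤m) ⟨
      Cₘₗ * (l! * r!) * K    ≡⟨ solve 4 (λ C l! r! K → C :* (l! :* r!) :* K := C :* l! :* (K :* r!)) refl Cₘₗ l! r! K ⟩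
      Cₘₗ * l! * (K * r!)    ≡⟨ cong (Cₘₗ * l! *_) (fromℕ-* k (r !)) ⟨
      Cₘₗ * l! * k!          ∎

  degOrderedBell-Bernoulli : ∀ x m → degOrderedBell lam (suc m) x
    ≡ sumTo m (λ l → lam ^ l * fromℕ (m C l) * higherBernoulli (suc m) l * orderedBell (suc m ∸ l) x)
  degOrderedBell-Bernoulli x m = begin
    fromℕ (suc m !) * (sinv (const (fromℕ 2) ⊖ degExp lam 1ℚ) ⊛ degExp lam x) (suc m)
      ≡⟨ cong (fromℕ (suc m !) *_) (degOrderedBellGen≐orderedBellGen∘ₛdegLog x (suc m)) ⟩
    fromℕ (suc m !) * sumTo (suc m) (λ k → (orderedBellGen ⊛ expLin x) k * spow L k (suc m))
      ≡⟨ *-distribˡ-sumTo (suc m) (fromℕ (suc m !)) _ ⟩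
    sumTo (suc m) T
      ≡⟨ sumTo-reverse (suc m) T ⟩
    sumTo m (λ l → T (suc m ∸ l)) + T (m ∸ m)
      ≡⟨ cong (sumTo m (λ l → T (suc m ∸ l)) +_) T[m∸m]≡0 ⟩
    sumTo m (λ l → T (suc m ∸ l)) + 0ℚ
      ≡⟨ ℚₚ.+-identityʳ _ ⟩
    sumTo m (λ l → T (suc m ∸ l))
      ≡⟨ sumTo-cong≤ m (degOrderedBell-term x m) ⟩
    sumTo m (λ l → lam ^ l * fromℕ (m C l) * higherBernoulli (suc m) l * orderedBell (suc m ∸ l) x)
      ∎
    where
    open ≡-Reasoning
    T : ℕ → ℚ
    T k = fromℕ (suc m !) * ((orderedBellGen ⊛ expLin x) k * spow L k (suc m))
    T[m∸m]≡0 : T (m ∸ m) ≡ 0ℚ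
    T[m∸m]≡0 rewrite ℕₚ.n∸n≡0 m =
      trans (cong (fromℕ (suc m !) *_) (ℚₚ.*-zeroʳ ((orderedBellGen ⊛ expLin x) 0))) (ℚₚ.*-zeroʳ (fromℕ (suc m !)))

  Bernoulli-sum-expanded : ∀ x m →
    sumTo m (λ l → lam ^ l * fromℕ (m C l) * higherBernoulli (suc m) l * orderedBell (suc m ∸ l) x)
      ≡ sumTo (suc m) (λ l → sumTo (suc m ∸ l) (λ i →
          lam ^ l * fromℕ (m C l) * fromℕ ((suc m ∸ l) C i) * higherBernoulli (suc m) l * orderedBellNum i * (x ^ ((suc m ∸ l) ∸ i))))
  Bernoulli-sum-expanded x m = begin
    sumTo m (λ l → A l * orderedBell (suc m ∸ l) x) ≡⟨ sumTo-cong m expand ⟩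
    sumTo m G                                       ≡⟨ ℚₚ.+-identityʳ _ ⟨
    sumTo m G + 0ℚ                                  ≡⟨ cong (sumTo m G +_) G[1+m]≡0 ⟨
    sumTo m G + G (suc m)                           ∎
    where
    open ≡-Reasoning
    open +-*-Solver
    A : ℕ → ℚ
    A l = lam ^ l * fromℕ (m C l) * higherBernoulli (suc m) l
    F : ℕ → ℕ → ℚ
    F l i = lam ^ l * fromℕ (m C l) * fromℕ ((suc m ∸ l) C i) * higherBernoulli (suc m) l * orderedBellNum i * (x ^ ((suc m ∸ l) ∸ i))
    G : ℕ → ℚ
    G l = sumTo (suc m ∸ l) (F l)
    expand : ∀ l → A l * orderedBell (suc m ∸ l) x ≡ G l
    expand l = trans (cong (A l *_) (orderedBell-binomial (suc m ∸ l) x)) (trans (*-distribˡ-sumTo (suc m ∸ l) (A l) _)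
      (sumTo-cong (suc m ∸ l) (λ i → solve 6 (λ ℓˡ C B Cᵢ bᵢ xʳ → ℓˡ :* C :* B :* (Cᵢ :* bᵢ :* xʳ) := ℓˡ :* C :* Cᵢ :* B :* bᵢ :* xʳ) refl
         (lam ^ l) (fromℕ (m C l)) (higherBernoulli (suc m) l) (fromℕ ((suc m ∸ l) C i)) (orderedBellNum i) (x ^ ((suc m ∸ l) ∸ i)))))
    G[1+m]≡0 : G (suc m) ≡ 0ℚ
    G[1+m]≡0 = sumTo-zero (suc m ∸ suc m) F[1+m]≡0
      where
      F[1+m]≡0 : ∀ i → i ≤ m ∸ m → F (suc m) i ≡ 0ℚ
      F[1+m]≡0 i _ = begin
        ℓ * fromℕ (m C suc m) * Cᵢ * B * bᵢ * xʳ  ≡⟨ cong (λ c → ℓ * fromℕ c * Cᵢ * B * bᵢ * xʳ) (k>n⇒nCk≡0 (ℕₚ.n<1+n m)) ⟩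
        ℓ * 0ℚ * Cᵢ * B * bᵢ * xʳ                 ≡⟨ solve 5 (λ ℓ Cᵢ B bᵢ xʳ → ℓ :* con 0ℚ :* Cᵢ :* B :* bᵢ :* xʳ := con 0ℚ)
                                                              refl ℓ Cᵢ B bᵢ xʳ ⟩
        0ℚ                                        ∎
        where
        ℓ  = lam ^ suc m
        Cᵢ = fromℕ ((m ∸ m) C i)
        B  = higherBernoulli (suc m) (suc m)
        bᵢ = orderedBellNum i
        xʳ = x ^ ((m ∸ m) ∸ i)

theorem5 : (lam : ℚ) → .{{_ : NonZero lam}} → (n : ℕ) → n ≥ 1 → (x : ℚ) →
    (degOrderedBell lam n x
      ≡ sumTo (n ∸ 1) (λ l → (lam ^ l) * fromℕ ((n ∸ 1) C l)
                              * higherBernoulli n l * orderedBell (n ∸ l) x))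
    × (sumTo (n ∸ 1) (λ l → (lam ^ l) * fromℕ ((n ∸ 1) C l)
                              * higherBernoulli n l * orderedBell (n ∸ l) x)
      ≡ sumTo n (λ l → sumTo (n ∸ l) (λ m →
          (lam ^ l) * fromℕ ((n ∸ 1) C l) * fromℕ ((n ∸ l) C m)
            * higherBernoulli n l * orderedBellNum m * (x ^ ((n ∸ l) ∸ m)))))
theorem5 lam (suc m) _ x = degOrderedBell-Bernoulli lam x m , Bernoulli-sum-expanded lam x m
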